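{- Let $H$ be the bipartite graph with sides $\{u_i:i\in\mathbb{N}\}$ and $\{v_i:i\in\mathbb{N}\}$ in which $u_iv_j$ is an edge if and only if $0\le j\le i+1$. Let $\{H_n:n\in\mathbb{N}\}$ be pairwise disjoint copies of $H$, where $A_n$ denotes the copy of $\{u_i\}$ and $B_n$ the copy of $\{v_i\}$ in $H_n$. Let $Y=\{y_i:i\in\mathbb{N}\}$ be new vertices, and let $\Gamma$ be the graph with vertex set $\bigcup_{n}V(H_n)\cup Y$ and edge set $\bigcup_n E(H_n)\cup\bigcup_{i\in\mathbb{N}}\{y_iv: v\in A_n,\ i-1\le n\}$. Then $\Gamma$ is an infinite countable bipartite dHp graph with sides $S=\bigcup_n A_n$ and $R=\bigcup_n B_n\cup Y$, in which every vertex of $S$ has finite degree. Furthermore, every collection of pairwise vertex-disjoint 2-regular subgraphs of $\Gamma$ that covers $S$ has infinitely many connected components.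
   Context: For $X\subseteq V(G)$ with $|X|\ge 2$, $N^2(X)$ denotes the set of vertices of $G$ having at least two neighbours in $X$. A bipartite graph $G$ with sides $A$ and $B$ is a dHp graph if $|A|\ge 2$ and $|N^2(X)|\ge |X|$ for every $X\subseteq A$ with $|X|\ge 2$ (here the first side is $S$). A 2-regular subgraph is a subgraph in which every vertex has degree exactly $2$. A collection of subgraphs covers $S$ if every vertex of $S$ lies in one of them. -}

module Defs where

open import Data.Nat using (ℕ; _≤_; _∸_; _+_)
open import Data.Product using (Σ; _×_; _,_; ∃)
open import Data.Sum using (_⊎_; inj₁; inj₂)
open import Data.Empty using (⊥)
open import Data.Unit using (⊤)
open import Data.List using (List; length)
open import Data.List.Membership.Propositional using (_∈_)
open import Data.List.Relation.Unary.Unique.Propositional using (Unique)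
open import Data.List.Relation.Unary.Any using (Any)
open import Relation.Binary.PropositionalEquality using (_≡_; _≢_)
open import Relation.Nullary using (¬_)
open import Function.Bundles using (_↣_)

-- Side S = ⋃ₙ Aₙ : the vertex (n , i) is the copy of u_i in H_n.
-- Side R = ⋃ₙ Bₙ ∪ Y : inj₁ (n , j) is the copy of v_j in H_n,
--                      inj₂ k is the new vertex y_k.

SVert : Set
SVert = ℕ × ℕ

RVert : Set
RVert = (ℕ × ℕ) ⊎ ℕ

V : Set
V = SVert ⊎ RVert

-- Edges between S and R.
--   u_i v_j ∈ E(H_n)  iff  j ≤ i + 1   (within the same copy n)
--   y_k v ∈ E(Γ) for v ∈ A_n  iff  k - 1 ≤ n  (truncated subtraction;
--   for k = 0 the condition -1 ≤ n holds, as does 0 ≤ n)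
EdgeSR : SVert → RVert → Set
EdgeSR (n , i) (inj₁ (m , j)) = (n ≡ m) × (j ≤ i + 1)
EdgeSR (n , i) (inj₂ k)       = k ∸ 1 ≤ n

Adj : V → V → Set
Adj (inj₁ s) (inj₂ r) = EdgeSR s r
Adj (inj₂ r) (inj₁ s) = EdgeSR s r
Adj (inj₁ _) (inj₁ _) = ⊥
Adj (inj₂ _) (inj₂ _) = ⊥

InS : V → Set
InS (inj₁ _) = ⊤
InS (inj₂ _) = ⊥

InR : V → Set
InR (inj₁ _) = ⊥
InR (inj₂ _) = ⊤

CountablyInfinite : Set → Set
CountablyInfinite A = (A ↣ ℕ) × (ℕ ↣ A)

BipartiteSR : Set
BipartiteSR = ∀ x y → Adj x y → (InS x × InR y) ⊎ (InR x × InS y)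

TwoNbrsIn : List SVert → V → Set
TwoNbrsIn X v = Σ SVert λ a → Σ SVert λ b →
  a ≢ b × a ∈ X × b ∈ X × Adj v (inj₁ a) × Adj v (inj₁ b)

-- dHp property with first side S (for finite X ⊆ S):
-- |S| ≥ 2, and for every X ⊆ S with |X| ≥ 2 there are at least |X|
-- distinct vertices in N²(X).
IsDHp : Set
IsDHp =
  (Σ SVert λ a → Σ SVert λ b → a ≢ b) ×
  (∀ (X : List SVert) → Unique X → 2 ≤ length X →
     Σ (List V) λ Z → Unique Z × length X ≤ length Z ×
       (∀ v → v ∈ Z → TwoNbrsIn X v))

FiniteDegreeS : Set
FiniteDegreeS = ∀ (s : SVert) → Σ (List V) λ L → ∀ v → Adj (inj₁ s) v → v ∈ L

record Subgraph : Set₁ where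
  field
    Vs    : V → Set
    Es    : V → V → Set
    E⊆Adj : ∀ {x y} → Es x y → Adj x y
    E-sym : ∀ {x y} → Es x y → Es y x
    E-ends : ∀ {x y} → Es x y → Vs x × Vs y
open Subgraph public

TwoRegular : Subgraph → Set
TwoRegular F = ∀ x → Vs F x →
  Σ V λ a → Σ V λ b → a ≢ b × Es F x a × Es F x b ×
    (∀ c → Es F x c → (c ≡ a) ⊎ (c ≡ b))

data Reach (F : Subgraph) : V → V → Set where
  here  : ∀ {x} → Reach F x x
  step  : ∀ {x y z} → Es F x y → Reach F y z → Reach F x z

Collection : Set → Set₁
Collection I = I → Subgraph

PairwiseVertexDisjoint : ∀ {I : Set} → Collection I → Set
PairwiseVertexDisjoint {I} 𝓕 = ∀ (i j : I) x → Vs (𝓕 i) x → Vs (𝓕 j) x → i ≡ j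

CoversS : ∀ {I : Set} → Collection I → Set
CoversS {I} 𝓕 = ∀ (s : SVert) → Σ I λ i → Vs (𝓕 i) (inj₁ s)

-- The components of the collection are the components of its members.
-- "Finitely many components": a finite list of representatives (i , x),
-- x ∈ 𝓕 i, such that every vertex of every member lies in the same
-- component as some representative.
FinitelyManyComponents : ∀ {I : Set} → Collection I → Set
FinitelyManyComponents {I} 𝓕 =
  Σ (List (I × V)) λ L →
    (∀ i x → (i , x) ∈ L → Vs (𝓕 i) x) ×
    (∀ j y → Vs (𝓕 j) y →
       Any (λ p → Σ (Data.Product.proj₁ p ≡ j) λ _ →
                  Reach (𝓕 j) y (Data.Product.proj₂ p)) L)

InfinitelyManyComponents : ∀ {I : Set} → Collection I → Set
InfinitelyManyComponents 𝓕 = ¬ FinitelyManyComponents 𝓕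

-- dHp: send x = u_i ∈ X ∩ A_n to v_{i+1} ∈ B_n if X has a later vertex in A_n, else to y_{n+1}
-- if X meets a later copy, else to y_0.  Each image is adjacent to x and to that later vertex
-- (y_0 to every vertex of S), and the map is injective on X.
--
-- Components: a component of a 2-regular subgraph is traced from any of its vertices by two rays.
-- H_n meets the rest of Γ only in y_0, …, y_{n+1}.  If no ray stays in H_n from some point on, the
-- walks entering H_n through these vertices all leave again, so the heights i of the vertices u_i
-- they reach in H_n are bounded, while every u_i of H_n must be reached.  So every copy free of
-- representatives holds the tail of a ray; a ray has only one tail, and finitely many components
-- give finitely many rays.  Since the conclusion is negative, the argument runs in the
-- double-negation monad.

module Submission where

open import Defs
open import Data.Empty using (⊥; ⊥-elim)
open import Data.Fin using (Fin; zero; suc; toℕ; combine)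
import Data.Fin.Properties as Fin
open import Data.List using (List; []; _∷_; _++_; map; length; lookup; applyUpTo)
open import Data.List.Membership.Propositional using (_∈_; find; lose)
open import Data.List.Membership.Propositional.Properties
  using (∈-map⁺; ∈-map⁻; ∈-++⁺ˡ; ∈-++⁺ʳ; ∈-applyUpTo⁺; ∈-lookup)
open import Data.List.Properties using (length-map)
open import Data.List.Relation.Unary.All as All using (_∷_)
import Data.List.Relation.Unary.All.Properties as All
open import Data.List.Relation.Unary.Any using (Any; here; there; any?; index)
open import Data.List.Relation.Unary.Any.Properties using (lookup-index)
open import Data.List.Relation.Unary.AllPairs using ([]; _∷_)
open import Data.List.Relation.Unary.Unique.Propositional using (Unique)
open import Data.Nat
open import Data.Nat.Properties
open import Data.Product using (Σ; ∃; ∃₂; _×_; _,_; proj₁; proj₂)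
import Data.Product.Properties as Product
open import Data.Sum using (_⊎_; inj₁; inj₂; [_,_]′)
import Data.Sum.Properties as Sum
open import Data.Unit using (tt)
open import Effect.Monad using (RawMonad)
open import Function using (_∘_; id; case_of_)
open import Function.Bundles using (mk↣)
open import Function.Consequences.Propositional using (inverseʳ⇒injective; strictlyInverseʳ⇒inverseʳ)
open import Level using (0ℓ)
open import Relation.Binary.Definitions using (DecidableEquality)
open import Relation.Binary.PropositionalEquality
open import Relation.Nullary using (¬_; Dec; yes; no; _×-dec_; decidable-stable; ¬¬-excluded-middle)
open import Relation.Nullary.Negation using (¬¬-Monad)
open import Relation.Unary using (Decidable)

open RawMonad (¬¬-Monad {0ℓ}) using (pure; _>>=_)

pattern u[_,_] n i = inj₁ (n , i)
pattern v[_,_] n j = inj₂ (inj₁ (n , j))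
pattern y[_] k     = inj₂ (inj₂ k)

triangle : ℕ → ℕ
triangle zero = zero
triangle (suc s) = triangle s + suc s

pair : ℕ × ℕ → ℕ
pair (a , b) = triangle (a + b) + a

unpair-step : ℕ × ℕ → ℕ × ℕ
unpair-step (a , suc b) = suc a , b
unpair-step (a , zero) = zero , suc a

unpair : ℕ → ℕ × ℕ
unpair zero = 0 , 0
unpair (suc n) = unpair-step (unpair n)

unpair-triangle : ∀ s a b → a + b ≡ s → unpair (triangle s + a) ≡ (a , b)
unpair-triangle zero zero _ refl = refl
unpair-triangle (suc s) zero _ refl = begin
  unpair (triangle s + suc s + 0)       ≡⟨ cong unpair (trans (+-identityʳ _) (+-suc (triangle s) s)) ⟩
  unpair-step (unpair (triangle s + s)) ≡⟨ cong unpair-step (unpair-triangle s s 0 (+-identityʳ s)) ⟩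
  (0 , suc s)                           ∎
  where open ≡-Reasoning
unpair-triangle s (suc a) b a+b≡s = begin
  unpair (triangle s + suc a)           ≡⟨ cong unpair (+-suc (triangle s) a) ⟩
  unpair-step (unpair (triangle s + a)) ≡⟨ cong unpair-step (unpair-triangle s a (suc b) (trans (+-suc a b) a+b≡s)) ⟩
  (suc a , b)                           ∎
  where open ≡-Reasoning

unpair-pair : ∀ p → unpair (pair p) ≡ p
unpair-pair (a , b) = unpair-triangle (a + b) a b refl

tag : V → ℕ × ℕ
tag (inj₁ u) = 0 , pair u
tag (inj₂ (inj₁ v)) = 1 , pair v
tag (inj₂ (inj₂ m)) = 2 , m

untag : ℕ × ℕ → V
untag (0 , c) = inj₁ (unpair c)
untag (1 , c) = inj₂ (inj₁ (unpair c))
untag (_ , c) = inj₂ (inj₂ c)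

untag-tag : ∀ x → untag (tag x) ≡ x
untag-tag (inj₁ u) = cong inj₁ (unpair-pair u)
untag-tag (inj₂ (inj₁ v)) = cong (inj₂ ∘ inj₁) (unpair-pair v)
untag-tag (inj₂ (inj₂ m)) = refl

encode : V → ℕ
encode = pair ∘ tag

decode : ℕ → V
decode = untag ∘ unpair

decode-encode : ∀ x → decode (encode x) ≡ x
decode-encode x = trans (cong untag (unpair-pair (tag x))) (untag-tag x)

countablyInfinite : CountablyInfinite V
countablyInfinite =
  mk↣ (inverseʳ⇒injective encode (strictlyInverseʳ⇒inverseʳ {f⁻¹ = decode} encode decode-encode)) ,
  mk↣ {to = λ k → y[ k ]} λ { refl → refl }

bipartite : BipartiteSR
bipartite (inj₁ _) (inj₂ _) _ = inj₁ (tt , tt)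
bipartite (inj₂ _) (inj₁ _) _ = inj₂ (tt , tt)

∸1≤⇒≤suc : ∀ k {n} → k ∸ 1 ≤ n → k ≤ suc n
∸1≤⇒≤suc zero _ = z≤n
∸1≤⇒≤suc (suc k) k≤n = s≤s k≤n

finiteDegree : FiniteDegreeS
finiteDegree (n , i) = applyUpTo inB (suc (i + 1)) ++ applyUpTo inY (suc (suc n)) , neighbour∈
  where
  inB inY : ℕ → V
  inB j = v[ n , j ]
  inY k = y[ k ]

  neighbour∈ : ∀ v → Adj u[ n , i ] v → v ∈ applyUpTo inB (suc (i + 1)) ++ applyUpTo inY (suc (suc n))
  neighbour∈ v[ _ , j ] (refl , j≤i+1) = ∈-++⁺ˡ (∈-applyUpTo⁺ inB (s≤s j≤i+1))
  neighbour∈ y[ k ] k∸1≤n =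
    ∈-++⁺ʳ (applyUpTo inB (suc (i + 1))) (∈-applyUpTo⁺ inY (s≤s (∸1≤⇒≤suc k k∸1≤n)))

other-element : ∀ {A : Set} {xs : List A} → DecidableEquality A → Unique xs → 2 ≤ length xs →
                ∀ x → ∃ λ y → y ∈ xs × x ≢ y
other-element {xs = a ∷ b ∷ _} _≟_ ((a≢b ∷ _) ∷ _) _ x with x ≟ a
... | yes refl = b , there (here refl) , a≢b
... | no x≢a = a , here refl , x≢a
other-element {xs = _ ∷ []} _ _ (s≤s ()) _

Unique-map⁺ : ∀ {A B : Set} {f : A → B} {xs : List A} →
              (∀ {x y} → x ∈ xs → y ∈ xs → f x ≡ f y → x ≡ y) → Unique xs → Unique (map f xs)
Unique-map⁺ {xs = []} _ [] = []
Unique-map⁺ {xs = x ∷ xs} injective (x∉xs ∷ unique) =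
  All.map⁺ (All.tabulate λ y∈xs fx≡fy → All.lookup x∉xs y∈xs (injective (here refl) (there y∈xs) fx≡fy)) ∷
  Unique-map⁺ (λ x∈ y∈ → injective (there x∈) (there y∈)) unique

module Slots (X : List SVert) where

  HasLaterInCopy : SVert → Set
  HasLaterInCopy (n , i) = Any (λ (m , j) → m ≡ n × i < j) X

  HasLaterCopy : ℕ → Set
  HasLaterCopy n = Any (λ (m , _) → n < m) X

  slot : (x : SVert) → Dec (HasLaterInCopy x) → Dec (HasLaterCopy (proj₁ x)) → V
  slot (n , i) (yes _) _       = v[ n , suc i ]
  slot (n , _) (no _)  (yes _) = y[ suc n ]
  slot _       (no _)  (no _)  = y[ 0 ]

  last-in-copy-unique : ∀ {n i i'} → (n , i) ∈ X → (n , i') ∈ X →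
                        ¬ HasLaterInCopy (n , i) → ¬ HasLaterInCopy (n , i') → i ≡ i'
  last-in-copy-unique x∈ x'∈ ¬later ¬later' =
    ≤-antisym (≮⇒≥ (¬later' ∘ lose x∈ ∘ (refl ,_))) (≮⇒≥ (¬later ∘ lose x'∈ ∘ (refl ,_)))

  last-copy-unique : ∀ {n i n' i'} → (n , i) ∈ X → (n' , i') ∈ X →
                     ¬ HasLaterCopy n → ¬ HasLaterCopy n' → n ≡ n'
  last-copy-unique x∈ x'∈ ¬later ¬later' = ≤-antisym (≮⇒≥ (¬later' ∘ lose x∈)) (≮⇒≥ (¬later ∘ lose x'∈))

  slot-injective : ∀ {x x'} → x ∈ X → x' ∈ X →
    (l : Dec (HasLaterInCopy x)) (c : Dec (HasLaterCopy (proj₁ x)))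
    (l' : Dec (HasLaterInCopy x')) (c' : Dec (HasLaterCopy (proj₁ x'))) →
    slot x l c ≡ slot x' l' c' → x ≡ x'
  slot-injective {_ , _} {_ , _} _ _ (yes _) _ (yes _) _ refl = refl
  slot-injective {_ , _} {_ , _} _ _ (yes _) _ (no _) (yes _) ()
  slot-injective {_ , _} {_ , _} _ _ (yes _) _ (no _) (no _) ()
  slot-injective {_ , _} {_ , _} _ _ (no _) (yes _) (yes _) _ ()
  slot-injective {_ , _} {_ , _} _ _ (no _) (no _) (yes _) _ ()
  slot-injective {_ , _} {_ , _} _ _ (no _) (yes _) (no _) (no _) ()
  slot-injective {_ , _} {_ , _} _ _ (no _) (no _) (no _) (yes _) ()
  slot-injective x∈ x'∈ (no ¬l) (yes _) (no ¬l') (yes _) refl =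
    cong (_ ,_) (last-in-copy-unique x∈ x'∈ ¬l ¬l')
  slot-injective {n , _} x∈ x'∈ (no ¬l) (no ¬c) (no ¬l') (no ¬c') _
    with refl ← last-copy-unique x∈ x'∈ ¬c ¬c' = cong (n ,_) (last-in-copy-unique x∈ x'∈ ¬l ¬l')

  slot-in-N² : Unique X → 2 ≤ length X → ∀ {x} → x ∈ X →
    (l : Dec (HasLaterInCopy x)) (c : Dec (HasLaterCopy (proj₁ x))) → TwoNbrsIn X (slot x l c)
  slot-in-N² _ _ {n , i} x∈ (yes later) _ with find later
  ... | (_ , j) , x'∈ , refl , i<j =
    (n , i) , (n , j) , (λ eq → <-irrefl (cong proj₂ eq) i<j) , x∈ , x'∈ ,
    (refl , m<m+n i z<s) , (refl , ≤-trans i<j (m≤m+n j 1))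
  slot-in-N² _ _ {n , i} x∈ (no _) (yes later) with find later
  ... | (m , j) , x'∈ , n<m =
    (n , i) , (m , j) , (λ eq → <-irrefl (cong proj₁ eq) n<m) , x∈ , x'∈ , ≤-refl , <⇒≤ n<m
  slot-in-N² unique 2≤|X| {x} x∈ (no _) (no _) with other-element (Product.≡-dec _≟_ _≟_) unique 2≤|X| x
  ... | x' , x'∈ , x≢x' = x , x' , x≢x' , x∈ , x'∈ , z≤n , z≤n

  hasLaterInCopy? : ∀ x → Dec (HasLaterInCopy x)
  hasLaterInCopy? (n , i) = any? (λ (m , j) → (m ≟ n) ×-dec (i <? j)) X

  hasLaterCopy? : ∀ n → Dec (HasLaterCopy n)
  hasLaterCopy? n = any? (λ (m , _) → n <? m) X

  assign : SVert → V
  assign x = slot x (hasLaterInCopy? x) (hasLaterCopy? (proj₁ x))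

dHp : IsDHp
dHp = ((0 , 0) , (0 , 1) , λ ()) , λ X unique 2≤|X| →
  let open Slots X in
  map assign X ,
  Unique-map⁺ (λ {x} {x'} x∈ x'∈ → slot-injective x∈ x'∈
    (hasLaterInCopy? x) (hasLaterCopy? (proj₁ x)) (hasLaterInCopy? x') (hasLaterCopy? (proj₁ x'))) unique ,
  ≤-reflexive (sym (length-map assign X)) ,
  λ v v∈ → let (x , x∈ , v≡) = ∈-map⁻ assign v∈ in
    subst (TwoNbrsIn X) (sym v≡) (slot-in-N² unique 2≤|X| x∈ (hasLaterInCopy? x) (hasLaterCopy? (proj₁ x)))

StaysUpTo : (ℕ → Set) → ℕ → Set
StaysUpTo P s = ∀ t → 1 ≤ t → t ≤ s → P t

finite-upper-bound : (Q : ℕ → ℕ → Set) → (∀ {m B B'} → B ≤ B' → Q m B → Q m B') →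
                     ∀ M → (∀ m → m < M → ∃ (Q m)) → ∃ λ B → ∀ m → m < M → Q m B
finite-upper-bound Q mono zero _ = 0 , λ _ ()
finite-upper-bound Q mono (suc M) bounds
  with finite-upper-bound Q mono M (λ m m<M → bounds m (m<n⇒m<1+n m<M)) | bounds M ≤-refl
... | B , below | B' , at = B + B' , λ m m<1+M →
  [ (λ m<M → mono (m≤m+n B B') (below m m<M)) , (λ { refl → mono (m≤n+m B' B) at }) ]′ (m<1+n⇒m<n∨m≡n m<1+M)

run-bounded : (P : ℕ → Set) (g : ℕ → ℕ) {s₀ : ℕ} → 1 ≤ s₀ → ¬ P s₀ → ∃ λ B → ∀ s → StaysUpTo P s → g s < B
run-bounded P g {s₀} 1≤s₀ ¬Ps₀ =
  let (B , bound) = finite-upper-bound (λ s B → g s < B) (λ B≤B' gs<B → <-≤-trans gs<B B≤B') (suc s₀)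
                                        (λ s _ → suc (g s) , ≤-refl)
  in B , λ s stays → bound s (s≤s (≮⇒≥ λ s₀<s → ¬Ps₀ (stays s₀ 1≤s₀ (<⇒≤ s₀<s))))

last-exit : ∀ {P : ℕ → Set} → Decidable P → ¬ P 0 → ∀ {k} → P k →
            ∃ λ k' → k' < k × ¬ P k' × (∀ t → k' < t → t ≤ k → P t)
last-exit P? ¬P0 {zero} P0 = ⊥-elim (¬P0 P0)
last-exit {P} P? ¬P0 {suc k} Pk+1 with P? k
... | no ¬Pk = k , ≤-refl , ¬Pk , λ t k<t t≤k+1 → subst P (≤-antisym k<t t≤k+1) Pk+1
... | yes Pk with last-exit P? ¬P0 Pk
...   | k' , k'<k , ¬Pk' , stays = k' , m<n⇒m<1+n k'<k , ¬Pk' , λ t k'<t t≤k+1 →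
  [ (λ t≤k → stays t k'<t (≤-pred t≤k)) , (λ { refl → Pk+1 }) ]′ (m≤n⇒m<n∨m≡n t≤k+1)

¬¬-∀< : ∀ {P : ℕ → Set} M → (∀ m → m < M → ¬ ¬ P m) → ¬ ¬ (∀ m → m < M → P m)
¬¬-∀< zero _ = pure λ _ ()
¬¬-∀< {P} (suc M) h = do
  below ← ¬¬-∀< M (λ m m<M → h m (m<n⇒m<1+n m<M))
  at ← h M ≤-refl
  pure λ m m<1+M → [ below m , (λ { refl → at }) ]′ (m<1+n⇒m<n∨m≡n m<1+M)

_≟V_ : DecidableEquality V
_≟V_ = Sum.≡-dec (Product.≡-dec _≟_ _≟_) (Sum.≡-dec (Product.≡-dec _≟_ _≟_) _≟_)

one-of-two : ∀ {A : Set} {a b x y z : A} →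
             x ≡ a ⊎ x ≡ b → y ≡ a ⊎ y ≡ b → z ≡ a ⊎ z ≡ b → y ≢ z → x ≡ y ⊎ x ≡ z
one-of-two (inj₁ refl) (inj₁ refl) _           _   = inj₁ refl
one-of-two (inj₂ refl) (inj₂ refl) _           _   = inj₁ refl
one-of-two (inj₁ refl) (inj₂ refl) (inj₁ refl) _   = inj₂ refl
one-of-two (inj₂ refl) (inj₁ refl) (inj₂ refl) _   = inj₂ refl
one-of-two (inj₁ refl) (inj₂ refl) (inj₂ refl) y≢z = ⊥-elim (y≢z refl)
one-of-two (inj₂ refl) (inj₁ refl) (inj₁ refl) y≢z = ⊥-elim (y≢z refl)

record Trail (F : Subgraph) (w : ℕ → V) : Set where
  field
    edge      : ∀ k → Es F (w k) (w (suc k))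
    no-u-turn : ∀ k → w (suc (suc k)) ≢ w k
open Trail public

trail-start∈ : ∀ {F w} → Trail F w → Vs F (w 0)
trail-start∈ {F} t = proj₁ (E-ends F (edge t 0))

trail-drop : ∀ {F w} → Trail F w → ∀ a → Trail F (λ k → w (k + a))
edge      (trail-drop t a) k = edge t (k + a)
no-u-turn (trail-drop t a) k = no-u-turn t (k + a)

record Neighbours (F : Subgraph) (x : V) : Set where
  field
    left right  : V
    distinct    : left ≢ right
    left-edge   : Es F x left
    right-edge  : Es F x right
    only        : ∀ {c} → Es F x c → c ≡ left ⊎ c ≡ right

open Neighbours

other-than : ∀ {F x} → Neighbours F x → V → Σ V (Es F x)
other-than N p with p ≟V left N
... | yes _ = right N , right-edge N
... | no _  = left N , left-edge N

other-than-≢ : ∀ {F x} (N : Neighbours F x) p → proj₁ (other-than N p) ≢ p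
other-than-≢ N p with p ≟V left N
... | yes refl = distinct N ∘ sym
... | no p≢left = p≢left ∘ sym

module TwoRegularSubgraph (F : Subgraph) (regular : TwoRegular F) where

  neighbours : ∀ {x} → Vs F x → Neighbours F x
  neighbours x∈ with regular _ x∈
  ... | a , b , a≢b , ea , eb , only = record
    { left = a ; right = b ; distinct = a≢b ; left-edge = ea ; right-edge = eb ; only = only _ }

  trail-neighbour : ∀ {w} → Trail F w → ∀ k {c} → Es F (w (suc k)) c → c ≡ w k ⊎ c ≡ w (suc (suc k))
  trail-neighbour t k e = one-of-two (only N e) (only N (E-sym F (edge t k))) (only N (edge t (suc k)))
                                     (λ eq → no-u-turn t k (sym eq))
    where N = neighbours (proj₁ (E-ends F e))

  Arc : Set
  Arc = Σ V λ p → Σ V (Es F p)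

  advance : Arc → Arc
  advance (p , x , e) = x , other-than (neighbours (proj₂ (E-ends F e))) p

  arcs : Arc → ℕ → Arc
  arcs α zero    = α
  arcs α (suc k) = advance (arcs α k)

  follow : Arc → ℕ → V
  follow α k = proj₁ (arcs α k)

  follow-Trail : ∀ α → Trail F (follow α)
  edge      (follow-Trail α) k = proj₂ (proj₂ (arcs α k))
  no-u-turn (follow-Trail α) k = other-than-≢ _ (follow α k)

  trails-agree : ∀ {w w'} → Trail F w → Trail F w' → w 0 ≡ w' 0 → w 1 ≡ w' 1 → ∀ k → w k ≡ w' k
  trails-agree {w} {w'} t t' e₀ e₁ k = proj₁ (agree k)
    where
    agree : ∀ k → w k ≡ w' k × w (suc k) ≡ w' (suc k)
    agree zero = e₀ , e₁
    agree (suc k) with agree k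
    ... | eₖ , eₖ₊₁ = eₖ₊₁ ,
      [ (λ eq → ⊥-elim (no-u-turn t' k (trans eq eₖ))) , sym ]′
        (trail-neighbour t k (subst (λ z → Es F z (w' (suc (suc k)))) (sym eₖ₊₁) (edge t' (suc k))))

  trail-returns : ∀ {w w' b} → Trail F w → Trail F w' → w 0 ≡ w' (suc b) → w 1 ≡ w' b → w (suc b) ≡ w' 0
  trail-returns {b = zero} _ _ _ e₁ = e₁
  trail-returns {w} {w'} {suc b} t t' e₀ e₁ =
    subst (λ k → w k ≡ w' 0) (+-comm (suc b) 1) (trail-returns (trail-drop t 1) t' e₁ w₂≡w'b)
    where
    w₂≡w'b : w 2 ≡ w' b
    w₂≡w'b = [ id , (λ eq → ⊥-elim (no-u-turn t 0 (trans eq (sym e₀)))) ]′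
      (trail-neighbour t' b (subst (λ z → Es F z (w 2)) e₁ (edge t 1)))

  module Rays {r : V} (r∈F : Vs F r) where

    private
      N = neighbours r∈F

    end : Fin 2 → Σ V (Es F r)
    end zero    = left N , left-edge N
    end (suc _) = right N , right-edge N

    end-only : ∀ {c} → Es F r c → ∃ λ d → c ≡ proj₁ (end d)
    end-only e = [ (zero ,_) , (suc zero ,_) ]′ (only N e)

    ray : Fin 2 → ℕ → V
    ray d = follow (r , end d)

    ray-trail : ∀ d → Trail F (ray d)
    ray-trail d = follow-Trail (r , end d)

    trail-from-root : ∀ {w} → Trail F w → w 0 ≡ r → ∃ λ d → ∀ k → w k ≡ ray d k
    trail-from-root t w₀≡r with end-only (subst (λ z → Es F z _) w₀≡r (edge t 0))
    ... | d , w₁≡ = d , trails-agree t (ray-trail d) w₀≡r w₁≡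

    reachable-on-ray : ∀ {v} → Reach F v r → ∃₂ λ d k → v ≡ ray d k
    reachable-on-ray here = zero , 0 , refl
    reachable-on-ray (step e path) with reachable-on-ray path
    ... | _ , zero , refl = let (d , eq) = end-only (E-sym F e) in d , 1 , eq
    ... | d , suc k , refl =
      [ (λ eq → d , k , eq) , (λ eq → d , suc (suc k) , eq) ]′ (trail-neighbour (ray-trail d) k (E-sym F e))

  escaping-trails-bounded : ∀ {x} → Vs F x → (P : V → Set) (g : V → ℕ) →
    (∀ {w} → Trail F w → w 0 ≡ x → ¬ ¬ ∃ λ s → 1 ≤ s × ¬ P (w s)) →
    ¬ ¬ ∃ λ B → ∀ {w} → Trail F w → w 0 ≡ x → ∀ s → StaysUpTo (P ∘ w) s → g (w s) < B
  escaping-trails-bounded {x} x∈F P g escapes = do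
    (B₀ , bound₀) ← ray-bounded zero
    (B₁ , bound₁) ← ray-bounded (suc zero)
    pure (B₀ + B₁ , λ {w} → via-ray (both bound₀ bound₁) {w})
    where
    open Rays x∈F

    RayBound : ℕ → Fin 2 → Set
    RayBound B d = ∀ s → StaysUpTo (P ∘ ray d) s → g (ray d s) < B

    ray-bounded : ∀ d → ¬ ¬ ∃ λ B → RayBound B d
    ray-bounded d = do
      (s₀ , 1≤s₀ , ¬Ps₀) ← escapes (ray-trail d) refl
      pure (run-bounded (P ∘ ray d) (g ∘ ray d) 1≤s₀ ¬Ps₀)

    both : ∀ {B₀ B₁} → RayBound B₀ zero → RayBound B₁ (suc zero) → ∀ d → RayBound (B₀ + B₁) d
    both {B₀} {B₁} b₀ _ zero    s stays = <-≤-trans (b₀ s stays) (m≤m+n B₀ B₁)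
    both {B₀} {B₁} _ b₁ (suc _) s stays = <-≤-trans (b₁ s stays) (m≤n+m B₁ B₀)

    via-ray : ∀ {B} → (∀ d → RayBound B d) →
              ∀ {w} → Trail F w → w 0 ≡ x → ∀ s → StaysUpTo (P ∘ w) s → g (w s) < B
    via-ray {B} bound t w₀≡x s stays with trail-from-root t w₀≡x
    ... | d , w≡ray = subst (λ v → g v < B) (sym (w≡ray s))
                        (bound d s λ u 1≤u u≤s → subst P (w≡ray u) (stays u 1≤u u≤s))

InCopy : ℕ → V → Set
InCopy n u[ m , _ ] = m ≡ n
InCopy n v[ m , _ ] = m ≡ n
InCopy n y[ _ ]     = ⊥

inCopy? : ∀ n → Decidable (InCopy n)
inCopy? n u[ m , _ ] = m ≟ n
inCopy? n v[ m , _ ] = m ≟ n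
inCopy? n y[ _ ]     = no λ ()

copyIndex : V → ℕ
copyIndex u[ m , _ ] = m
copyIndex v[ m , _ ] = m
copyIndex y[ _ ]     = 0

InCopy⇒copyIndex : ∀ {n v} → InCopy n v → copyIndex v ≡ n
InCopy⇒copyIndex {v = u[ _ , _ ]} refl = refl
InCopy⇒copyIndex {v = v[ _ , _ ]} refl = refl

copies-eventually-avoid : (xs : List V) → ∃ λ n₀ → ∀ {n x} → n₀ ≤ n → x ∈ xs → ¬ InCopy n x
copies-eventually-avoid [] = 0 , λ _ ()
copies-eventually-avoid (x ∷ xs) with copies-eventually-avoid xs
... | n₀ , avoid = suc (copyIndex x) ⊔ n₀ , λ where
  n₀≤n (here refl) x∈n → <-irrefl (InCopy⇒copyIndex x∈n) (≤-trans (m≤m⊔n _ n₀) n₀≤n)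
  n₀≤n (there x∈xs)    → avoid (≤-trans (m≤n⊔m _ n₀) n₀≤n) x∈xs

entry-through-Y : ∀ {n x v} → Adj x v → ¬ InCopy n x → InCopy n v → ∃ λ m → m ≤ suc n × x ≡ y[ m ]
entry-through-Y {x = u[ _ , _ ]} {v[ _ , _ ]} (refl , _) x∉ refl = ⊥-elim (x∉ refl)
entry-through-Y {x = v[ _ , _ ]} {u[ _ , _ ]} (refl , _) x∉ refl = ⊥-elim (x∉ refl)
entry-through-Y {x = y[ m ]}     {u[ _ , _ ]} m∸1≤n      _  refl = m , ∸1≤⇒≤suc m m∸1≤n , refl

height : V → ℕ
height u[ _ , i ] = i
height _          = 0

module Components {I : Set} (𝓕 : Collection I) (regular : ∀ i → TwoRegular (𝓕 i))
  (disjoint : PairwiseVertexDisjoint 𝓕) (covers : CoversS 𝓕) (finite : FinitelyManyComponents 𝓕) where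

  module T (i : I) = TwoRegularSubgraph (𝓕 i) (regular i)

  L : List (I × V)
  L = proj₁ finite

  Root : Set
  Root = Fin (length L)

  member : Root → I
  member q = proj₁ (lookup L q)

  root : Root → V
  root q = proj₂ (lookup L q)

  root∈ : ∀ q → Vs (𝓕 (member q)) (root q)
  root∈ q = proj₁ (proj₂ finite) _ _ (∈-lookup q)

  Ray : Set
  Ray = Root × Fin 2

  ray : Ray → ℕ → V
  ray (q , d) = T.Rays.ray (member q) (root∈ q) d

  ray-trail : ∀ ρ → Trail (𝓕 (member (proj₁ ρ))) (ray ρ)
  ray-trail (q , d) = T.Rays.ray-trail (member q) (root∈ q) d

  on-a-ray : ∀ {j v} → Vs (𝓕 j) v → Σ Ray λ ρ → member (proj₁ ρ) ≡ j × ∃ λ k → v ≡ ray ρ k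
  on-a-ray {j} {v} v∈ =
    let represented = proj₂ (proj₂ finite) j v v∈
        q = index represented
        (member≡j , path) = lookup-index represented
        (d , k , v≡) = T.Rays.reachable-on-ray (member q) (root∈ q)
                         (subst (λ i → Reach (𝓕 i) v (root q)) (sym member≡j) path)
    in (q , d) , member≡j , k , v≡

  SettlesIn : ℕ → Ray → Set
  SettlesIn n ρ = ∃ λ k₀ → ∀ k → k₀ ≤ k → InCopy n (ray ρ k)

  settles-in-one-copy : ∀ {m n ρ} → SettlesIn m ρ → SettlesIn n ρ → m ≡ n
  settles-in-one-copy (k₀ , in-m) (k₁ , in-n) =
    trans (sym (InCopy⇒copyIndex (in-m (k₀ + k₁) (m≤m+n k₀ k₁)))) (InCopy⇒copyIndex (in-n (k₀ + k₁) (m≤n+m k₁ k₀)))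

  module UnsettledCopy (n : ℕ) (roots-outside : ∀ q → ¬ InCopy n (root q))
                       (unsettled : ¬ Σ Ray (SettlesIn n)) where

    ray-leaves : ∀ ρ k₀ → ¬ ¬ ∃ λ k → k₀ ≤ k × ¬ InCopy n (ray ρ k)
    ray-leaves ρ k₀ stays = unsettled (ρ , k₀ , λ k k₀≤k →
      decidable-stable (inCopy? n (ray ρ k)) λ out → stays (k , k₀≤k , out))

    -- Past its first vertex the trail runs along a ray, either forwards (and that ray leaves H_n)
    -- or backwards to the ray's root, which lies outside H_n.
    trail-leaves : ∀ {i w} → Trail (𝓕 i) w → ¬ InCopy n (w 0) → ¬ ¬ ∃ λ s → 1 ≤ s × ¬ InCopy n (w s)
    trail-leaves {i} {w} t w₀-out with inCopy? n (w 1)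
    ... | no w₁-out = pure (1 , ≤-refl , w₁-out)
    ... | yes w₁-in with on-a-ray (proj₂ (E-ends (𝓕 i) (edge t 0)))
    ...   | ρ , refl , zero , w₁≡root = ⊥-elim (roots-outside (proj₁ ρ) (subst (InCopy n) w₁≡root w₁-in))
    ...   | ρ , refl , suc k , w₁≡ray
      with T.trail-neighbour _ (ray-trail ρ) k (subst (λ z → Es (𝓕 i) z (w 0)) w₁≡ray (E-sym (𝓕 i) (edge t 0)))
    ...     | inj₁ w₀≡ray = do
                (k' , k<k' , out) ← ray-leaves ρ (suc k)
                pure (k' ∸ k , m<n⇒0<n∸m k<k' , subst (¬_ ∘ InCopy n) (sym (w≡ray k<k')) out)
      where
      w≡ray : ∀ {k'} → k < k' → w (k' ∸ k) ≡ ray ρ k'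
      w≡ray k<k' = trans (T.trails-agree _ t (trail-drop (ray-trail ρ) k) w₀≡ray w₁≡ray _)
                         (cong (ray ρ) (m∸n+n≡m (<⇒≤ k<k')))
    ...     | inj₂ w₀≡ray =
                pure (suc (suc k) , s≤s z≤n ,
                      subst (¬_ ∘ InCopy n) (sym (T.trail-returns _ t (ray-trail ρ) w₀≡ray w₁≡ray)) (roots-outside _))

    EntryBound : ℕ → ℕ → Set
    EntryBound m B = ∀ {i w} → Trail (𝓕 i) w → w 0 ≡ y[ m ] →
                     ∀ s → StaysUpTo (InCopy n ∘ w) s → height (w s) < B

    entries-bounded : ∀ m → ¬ ¬ ∃ (EntryBound m)
    entries-bounded m = ¬¬-excluded-middle >>= λ where
      (no y∉) → pure (0 , λ {i} {_} t w₀≡y → ⊥-elim (y∉ (i , subst (Vs (𝓕 i)) w₀≡y (trail-start∈ t))))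
      (yes (i₀ , y∈)) → do
        (B , bound) ← T.escaping-trails-bounded i₀ y∈ (InCopy n) height
                        (λ t w₀≡y → trail-leaves t (subst (InCopy n) w₀≡y))
        pure (B , λ {i} {_} t w₀≡y →
          case disjoint i i₀ _ (subst (Vs (𝓕 i)) w₀≡y (trail-start∈ t)) y∈ of λ { refl → bound t w₀≡y })

    EntryBound-mono : ∀ {m B B'} → B ≤ B' → EntryBound m B → EntryBound m B'
    EntryBound-mono B≤B' bound t w₀≡y s stays = <-≤-trans (bound t w₀≡y s stays) B≤B'

    height-unbounded : ∀ B → ¬ (∀ m → m < suc (suc n) → EntryBound m B)
    height-unbounded B bound with covers (n , B)
    ... | j , u∈ with on-a-ray u∈
    ... | ρ , _ , k , u≡ray with last-exit (inCopy? n ∘ ray ρ) (roots-outside (proj₁ ρ)) (subst (InCopy n) u≡ray refl)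
    ... | k' , k'<k , out , inside
      with entry-through-Y (E⊆Adj (𝓕 (member (proj₁ ρ))) (edge (ray-trail ρ) k')) out (inside (suc k') ≤-refl k'<k)
    ... | m , m≤1+n , entry =
      <-irrefl height≡B (bound m (s≤s m≤1+n) (trail-drop (ray-trail ρ) k') entry (k ∸ k') stays)
      where
      k∸k'+k'≡k : k ∸ k' + k' ≡ k
      k∸k'+k'≡k = m∸n+n≡m (<⇒≤ k'<k)

      stays : StaysUpTo (λ t → InCopy n (ray ρ (t + k'))) (k ∸ k')
      stays t 1≤t t≤k∸k' = inside (t + k') (+-monoˡ-≤ k' 1≤t) (≤-trans (+-monoˡ-≤ k' t≤k∸k') (≤-reflexive k∸k'+k'≡k))

      height≡B : height (ray ρ (k ∸ k' + k')) ≡ B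
      height≡B = cong height (trans (cong (ray ρ) k∸k'+k'≡k) (sym u≡ray))

    impossible : ⊥
    impossible = ¬¬-∀< (suc (suc n)) (λ m _ → entries-bounded m) λ bounds →
      let (B , bound) = finite-upper-bound EntryBound EntryBound-mono (suc (suc n)) bounds
      in height-unbounded B bound

  copy-has-settling-ray : ∀ n → (∀ q → ¬ InCopy n (root q)) → ¬ ¬ Σ Ray (SettlesIn n)
  copy-has-settling-ray = UnsettledCopy.impossible

  code : Ray → Fin (length L * 2)
  code (q , d) = combine q d

  code-injective : ∀ {ρ ρ'} → code ρ ≡ code ρ' → ρ ≡ ρ'
  code-injective {q , d} {q' , d'} eq = let (q≡q' , d≡d') = Fin.combine-injective q d q' d' eq in cong₂ _,_ q≡q' d≡d'

  impossible : ⊥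
  impossible = ¬¬-∀< N (λ t _ → copy-has-settling-ray (n₀ + t) (roots-outside t)) no-injection
    where
    n₀ : ℕ
    n₀ = proj₁ (copies-eventually-avoid (map proj₂ L))

    roots-outside : ∀ t q → ¬ InCopy (n₀ + t) (root q)
    roots-outside t q = proj₂ (copies-eventually-avoid (map proj₂ L)) (m≤m+n n₀ t) (∈-map⁺ proj₂ (∈-lookup q))

    N : ℕ
    N = suc (length L * 2)

    no-injection : ¬ (∀ t → t < N → Σ Ray (SettlesIn (n₀ + t)))
    no-injection settling with Fin.pigeonhole (n<1+n _) (λ t → code (proj₁ (settling (toℕ t) (Fin.toℕ<n t))))
    ... | t₁ , t₂ , t₁<t₂ , same = <-irrefl (+-cancelˡ-≡ n₀ _ _ (settles-in-one-copy
            (subst (SettlesIn _) (code-injective same) (proj₂ (settling _ _))) (proj₂ (settling _ _)))) t₁<t₂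

infinitelyManyComponents : ∀ (I : Set) (𝓕 : Collection I) → (∀ i → TwoRegular (𝓕 i)) →
                           PairwiseVertexDisjoint 𝓕 → CoversS 𝓕 → InfinitelyManyComponents 𝓕
infinitelyManyComponents _ = Components.impossible

proposition2p4 : CountablyInfinite V × BipartiteSR × IsDHp × FiniteDegreeS ×
    (∀ (I : Set) (𝓕 : Collection I) → (∀ i → TwoRegular (𝓕 i)) →
    PairwiseVertexDisjoint 𝓕 → CoversS 𝓕 → InfinitelyManyComponents 𝓕)
proposition2p4 = countablyInfinite , bipartite , dHp , finiteDegree , infinitelyManyComponents
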